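{- Let $r\ge1$ and suppose $V_1,V_2,V_3$ are three $r$-dimensional subspaces of $GF(2)^{2r}$ such that $V_i\cap V_j=\{0\}$ for $i\ne j$. Then there exist $2^r-1$ two-dimensional subspaces of $GF(2)^{2r}$, any two of which meet only in the zero vector, whose union equals $V_1\cup V_2\cup V_3$. -}

module Defs where

open import Data.Bool using (Bool; true; false; _xor_; if_then_else_)
open import Data.Nat using (ℕ; zero; suc)
open import Data.Fin using (Fin; zero; suc)
open import Data.Vec using (Vec; replicate; zipWith)
open import Data.Product using (Σ; _×_; ∃)
open import Function using (_∘_)
open import Relation.Binary.PropositionalEquality using (_≡_)

-- Vectors of GF(2)^n, with GF(2) = Bool (xor = addition, and = multiplication)
Vector : ℕ → Set
Vector n = Vec Bool n

0v : ∀ {n} → Vector n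
0v {n} = replicate n false

_⊕_ : ∀ {n} → Vector n → Vector n → Vector n
_⊕_ = zipWith _xor_

scale : ∀ {n} → Bool → Vector n → Vector n
scale c v = if c then v else 0v

lincomb : ∀ {n k} → (Fin k → Bool) → (Fin k → Vector n) → Vector n
lincomb {k = zero}  c b = 0v
lincomb {k = suc k} c b = scale (c zero) (b zero) ⊕ lincomb (c ∘ suc) (b ∘ suc)

Subset : ℕ → Set₁
Subset n = Vector n → Set

-- linear subspace (closure under scalars is automatic over GF(2) given 0 and +)
record IsSubspace {n} (V : Subset n) : Set where
  field
    zero∈ : V 0v
    ⊕∈    : ∀ x y → V x → V y → V (x ⊕ y)

LinIndep : ∀ {n k} → (Fin k → Vector n) → Set
LinIndep b = ∀ c → lincomb c b ≡ 0v → ∀ i → c i ≡ false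

Spans : ∀ {n k} → (Fin k → Vector n) → Subset n → Set
Spans b V = ∀ x → (V x → ∃ λ c → x ≡ lincomb c b) × ((∃ λ c → x ≡ lincomb c b) → V x)

IsSubspaceOfDim : ∀ {n} → Subset n → ℕ → Set
IsSubspaceOfDim {n} V d =
  IsSubspace V × Σ (Fin d → Vector n) (λ b → LinIndep b × Spans b V)

MeetTrivially : ∀ {n} → Subset n → Subset n → Set
MeetTrivially V W = ∀ x → V x → W x → x ≡ 0v

-- Any two of V₁, V₂, V₃ are complementary: (v , w) ↦ v ⊕ w is injective on
-- Vᵢ × Vⱼ, which has as many elements as GF(2)^2r.  Let π₁, π₂ be the
-- projections onto V₁ along V₂ and onto V₂ along V₁.  For each of the 2^r - 1
-- nonzero s ∈ V₃ take the plane spanned by π₁ s and π₂ s, which is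
-- {0, π₁ s, π₂ s, s}.  As V₃ is also complementary to V₂ and to V₁, π₁ and π₂
-- restrict to bijections V₃ → V₁ and V₃ → V₂, so every nonzero vector of
-- V₁ ∪ V₂ ∪ V₃ lies in exactly one of these planes.

{-# OPTIONS --safe #-}
module Submission where

open import Data.Nat using (ℕ; _≤_; _*_; _^_; _∸_)
open import Data.Fin using (Fin)
open import Data.Product using (Σ; _×_; ∃)
open import Data.Sum using (_⊎_)
open import Relation.Binary.PropositionalEquality using (_≢_)
open import Function.Bundles using (_⇔_)
open import Defs

open import Algebra.Bundles using (AbelianGroup)
open import Algebra.Structures using (IsAbelianGroup)
import Algebra.Properties.AbelianGroup as AbelianGroupProperties
import Algebra.Properties.CommutativeSemigroup as CommutativeSemigroupProperties
open import Data.Bool using (Bool; true; false; _xor_)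
import Data.Bool as Bool
open import Data.Bool.Properties using (xor-assoc; xor-comm; xor-identityˡ; xor-identityʳ; xor-same)
open import Data.Fin using (zero; suc; punchIn; punchOut; _≟_)
open import Data.Fin.Properties
  using (any?; punchOut-injective; punchIn-injective; punchInᵢ≢i; punchIn-punchOut; <⇒notInjective; 2↔Bool; *↔×)
open import Data.Nat using (zero; suc; _+_; s≤s)
open import Data.Nat.Properties using (n<1+n; +-comm; +-identityʳ; m∸n+n≡m; m^n>0; ^-distribˡ-+-*)
open import Data.Product using (_,_; proj₁; proj₂)
open import Data.Product.Algebra using (×-cong)
open import Data.Sum using (inj₁; inj₂)
import Data.Sum as Sum
open import Data.Vec using (Vec; _∷_; []; lookup; tabulate; replicate)
open import Data.Vec.Properties
  using (zipWith-assoc; zipWith-comm; zipWith-identityˡ; zipWith-identityʳ;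
         lookup∘tabulate; tabulate∘lookup; tabulate-cong; lookup-replicate)
import Data.Vec.Properties as Vec
import Data.Vec.Recursive as Recursive
open import Data.Vec.Recursive.Properties using (↔Vec)
open import Function using (_∘_; id; case_of_; _↔_; Inverse; Injection; Injective)
open import Function.Properties.Inverse using (↔-sym; ↔-trans; ↔⇒↣)
open import Level using (0ℓ)
open import Relation.Binary.PropositionalEquality
  using (_≡_; refl; sym; trans; cong; cong₂; subst; isEquivalence; module ≡-Reasoning)
open import Relation.Nullary using (yes; no; contradiction)
open import Data.Empty using (⊥-elim)
open import Function.Bundles using (mk⇔)

⊕-isAbelianGroup : ∀ n → IsAbelianGroup _≡_ (_⊕_ {n}) 0v id
⊕-isAbelianGroup n = record
  { isGroup = record
    { isMonoid = record
      { isSemigroup = record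
        { isMagma = record { isEquivalence = isEquivalence ; ∙-cong = cong₂ _⊕_ }
        ; assoc = zipWith-assoc xor-assoc
        }
      ; identity = zipWith-identityˡ xor-identityˡ , zipWith-identityʳ xor-identityʳ
      }
    ; inverse = ⊕-self , ⊕-self
    ; ⁻¹-cong = id
    }
  ; comm = zipWith-comm xor-comm
  }
  where
  ⊕-self : ∀ {n} (x : Vector n) → x ⊕ x ≡ 0v
  ⊕-self []      = refl
  ⊕-self (b ∷ x) = cong₂ _∷_ (xor-same b) (⊕-self x)

⊕-abelianGroup : ℕ → AbelianGroup 0ℓ 0ℓ
⊕-abelianGroup n = record { isAbelianGroup = ⊕-isAbelianGroup n }

module _ {n : ℕ} where
  open AbelianGroup (⊕-abelianGroup n) public using ()
    renaming (comm to ⊕-comm; identityˡ to ⊕-identityˡ; identityʳ to ⊕-identityʳ; inverseˡ to ⊕-self)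
  open AbelianGroupProperties (⊕-abelianGroup n) public using ()
    renaming (inverseˡ-unique to ⊕≡0v⇒≡; \\-leftDividesˡ to x⊕[x⊕y]≡y; ∙-cancelˡ to ⊕-cancelˡ)
  open CommutativeSemigroupProperties (AbelianGroup.commutativeSemigroup (⊕-abelianGroup n)) public using ()
    renaming (interchange to ⊕-interchange)

[x⊕y]⊕[x⊕z]≡y⊕z : ∀ {n} (x y z : Vector n) → (x ⊕ y) ⊕ (x ⊕ z) ≡ y ⊕ z
[x⊕y]⊕[x⊕z]≡y⊕z x y z = begin
  (x ⊕ y) ⊕ (x ⊕ z)  ≡⟨ ⊕-interchange x y x z ⟩
  (x ⊕ x) ⊕ (y ⊕ z)  ≡⟨ cong (_⊕ (y ⊕ z)) (⊕-self x) ⟩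
  0v ⊕ (y ⊕ z)       ≡⟨ ⊕-identityˡ (y ⊕ z) ⟩
  y ⊕ z              ∎
  where open ≡-Reasoning

xor≡false⇒≡ : ∀ a b → a xor b ≡ false → a ≡ b
xor≡false⇒≡ false false _ = refl
xor≡false⇒≡ true  true  _ = refl

scale-xor : ∀ {n} a b (v : Vector n) → scale a v ⊕ scale b v ≡ scale (a xor b) v
scale-xor false b     v = ⊕-identityˡ (scale b v)
scale-xor true  false v = ⊕-identityʳ v
scale-xor true  true  v = ⊕-self v

lincomb-zero : ∀ {n k} (b : Fin k → Vector n) → lincomb (λ _ → false) b ≡ 0v
lincomb-zero {k = zero}  b = refl
lincomb-zero {k = suc k} b = trans (⊕-identityˡ _) (lincomb-zero (b ∘ suc))

lincomb-cong : ∀ {n k} {c d : Fin k → Bool} (b : Fin k → Vector n) →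
               (∀ i → c i ≡ d i) → lincomb c b ≡ lincomb d b
lincomb-cong {k = zero}  b c≗d = refl
lincomb-cong {k = suc k} b c≗d =
  cong₂ _⊕_ (cong (λ a → scale a (b zero)) (c≗d zero)) (lincomb-cong (b ∘ suc) (c≗d ∘ suc))

lincomb-⊕ : ∀ {n k} (c d : Fin k → Bool) (b : Fin k → Vector n) →
            lincomb c b ⊕ lincomb d b ≡ lincomb (λ i → c i xor d i) b
lincomb-⊕ {k = zero}  c d b = ⊕-identityˡ 0v
lincomb-⊕ {k = suc k} c d b =
  trans (⊕-interchange _ _ _ _)
        (cong₂ _⊕_ (scale-xor (c zero) (d zero) (b zero)) (lincomb-⊕ (c ∘ suc) (d ∘ suc) (b ∘ suc)))

Span : ∀ {n k} → (Fin k → Vector n) → Subset n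
Span b x = ∃ λ c → x ≡ lincomb c b

Span-isSubspace : ∀ {n k} (b : Fin k → Vector n) → IsSubspace (Span b)
Span-isSubspace b = record
  { zero∈ = (λ _ → false) , sym (lincomb-zero b)
  ; ⊕∈    = λ { x y (c , x≡) (d , y≡) →
              (λ i → c i xor d i) , trans (cong₂ _⊕_ x≡ y≡) (lincomb-⊕ c d b) }
  }

-- Coordinates are vectors rather than functions Fin r → Bool so that equal
-- coordinates are propositionally equal without function extensionality.
module Coordinates {n r} {V : Subset n} (dimV : IsSubspaceOfDim V r) where

  private
    basis : Fin r → Vector n
    basis = proj₁ (proj₂ dimV)

    independent : LinIndep basis
    independent = proj₁ (proj₂ (proj₂ dimV))

    spans : Spans basis V
    spans = proj₂ (proj₂ (proj₂ dimV))

  vec : Vec Bool r → Vector n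
  vec e = lincomb (lookup e) basis

  vec-∈ : ∀ e → V (vec e)
  vec-∈ e = proj₂ (spans (vec e)) (lookup e , refl)

  vec-surjective : ∀ {x} → V x → ∃ λ e → vec e ≡ x
  vec-surjective {x} x∈V with c , x≡ ← proj₁ (spans x) x∈V =
    tabulate c , sym (trans x≡ (lincomb-cong basis (sym ∘ lookup∘tabulate c)))

  vec-injective : Injective _≡_ _≡_ vec
  vec-injective {e} {e'} vec≡ = begin
    e                        ≡⟨ tabulate∘lookup e ⟨
    tabulate (lookup e)      ≡⟨ tabulate-cong lookup≗ ⟩
    tabulate (lookup e')     ≡⟨ tabulate∘lookup e' ⟩
    e'                       ∎
    where
    open ≡-Reasoning
    difference≡0v : lincomb (λ i → lookup e i xor lookup e' i) basis ≡ 0v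
    difference≡0v = trans (sym (lincomb-⊕ (lookup e) (lookup e') basis))
                          (trans (cong (_⊕ vec e') vec≡) (⊕-self (vec e')))
    lookup≗ : ∀ i → lookup e i ≡ lookup e' i
    lookup≗ i = xor≡false⇒≡ _ _ (independent _ difference≡0v i)

  vec-zero : vec (replicate r false) ≡ 0v
  vec-zero = trans (lincomb-cong basis (λ i → lookup-replicate i false)) (lincomb-zero basis)

  vec≡0v⇒≡zero : ∀ {e} → vec e ≡ 0v → e ≡ replicate r false
  vec≡0v⇒≡zero vec≡0v = vec-injective (trans vec≡0v (sym vec-zero))

  nonzero-∈ : 1 ≤ r → ∃ λ x → V x × x ≢ 0v
  nonzero-∈ (s≤s {n = k} _) = vec e₀ , vec-∈ e₀ , λ vec≡0v → case vec≡0v⇒≡zero {e₀} vec≡0v of λ ()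
    where
    e₀ : Vec Bool (suc k)
    e₀ = true ∷ replicate k false

Fin-injective⇒surjective : ∀ {m} (f : Fin m → Fin m) → Injective _≡_ _≡_ f →
                           ∀ y → ∃ λ x → f x ≡ y
Fin-injective⇒surjective {suc m} f f-injective y with any? (λ x → f x ≟ y)
... | yes hit = hit
... | no  miss = ⊥-elim (<⇒notInjective (n<1+n m) g-injective)
  where
  y≢f : ∀ x → y ≢ f x
  y≢f x y≡fx = miss (x , sym y≡fx)
  g : Fin (suc m) → Fin m
  g x = punchOut (y≢f x)
  g-injective : Injective _≡_ _≡_ g
  g-injective {x} {x'} gx≡gx' = f-injective (punchOut-injective (y≢f x) (y≢f x') gx≡gx')

↔Fin-injective⇒surjective : ∀ {a b m} {A : Set a} {B : Set b} → A ↔ Fin m → B ↔ Fin m →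
                            (f : A → B) → Injective _≡_ _≡_ f → ∀ y → ∃ λ x → f x ≡ y
↔Fin-injective⇒surjective A↔ B↔ f f-injective y =
  let i , f̂i≡ = Fin-injective⇒surjective (B.to ∘ f ∘ A.to) f̂-injective (B.to y)
  in  A.to i , B.injective f̂i≡
  where
  module A = Injection (↔⇒↣ (↔-sym A↔))
  module B = Injection (↔⇒↣ B↔)
  f̂-injective : Injective _≡_ _≡_ (B.to ∘ f ∘ A.to)
  f̂-injective = A.injective ∘ f-injective ∘ B.injective

Vec-Bool↔Fin : ∀ n → Vec Bool n ↔ Fin (2 ^ n)
Vec-Bool↔Fin n = ↔-sym (↔-trans (Recursive.Fin[m^n]↔Fin[m]^n 2 n)
                                 (↔-trans (Recursive.lift↔ n 2↔Bool) (↔Vec n)))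

meetTrivially-sym : ∀ {n} {V W : Subset n} → MeetTrivially V W → MeetTrivially W V
meetTrivially-sym meet x x∈W x∈V = meet x x∈V x∈W

complement-unique : ∀ {n} {V W : Subset n} → IsSubspace V → IsSubspace W → MeetTrivially V W →
                    ∀ {x v v'} → V v → V v' → W (x ⊕ v) → W (x ⊕ v') → v ≡ v'
complement-unique {W = W} V-sub W-sub meet {x} {v} {v'} v∈V v'∈V x⊕v∈W x⊕v'∈W =
  ⊕≡0v⇒≡ v v' (meet (v ⊕ v') (IsSubspace.⊕∈ V-sub v v' v∈V v'∈V)
    (subst W ([x⊕y]⊕[x⊕z]≡y⊕z x v v') (IsSubspace.⊕∈ W-sub _ _ x⊕v∈W x⊕v'∈W)))

record Complementary {n} (V W : Subset n) : Set where
  field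
    V-isSubspace : IsSubspace V
    W-isSubspace : IsSubspace W
    meet         : MeetTrivially V W
    split        : ∀ x → ∃ λ v → V v × W (x ⊕ v)

opaque
  complementary-by-dim : ∀ {n r s} {V W : Subset n} → r + s ≡ n →
                         IsSubspaceOfDim V r → IsSubspaceOfDim W s → MeetTrivially V W →
                         Complementary V W
  complementary-by-dim {n} {r} {s} {V} {W} r+s≡n dimV dimW meet = record
    { V-isSubspace = proj₁ dimV
    ; W-isSubspace = proj₁ dimW
    ; meet         = meet
    ; split        = split
    }
    where
    module CV = Coordinates dimV
    module CW = Coordinates dimW

    sum : Vec Bool r × Vec Bool s → Vector n
    sum (e , f) = CV.vec e ⊕ CW.vec f

    residue-∈ : ∀ p → W (sum p ⊕ CV.vec (proj₁ p))
    residue-∈ (e , f) = subst W (sym (trans (⊕-comm _ _) (x⊕[x⊕y]≡y _ _))) (CW.vec-∈ f)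

    sum-injective : Injective _≡_ _≡_ sum
    sum-injective {e , f} {e' , f'} sum≡ = cong₂ _,_ (CV.vec-injective vecV≡) (CW.vec-injective vecW≡)
      where
      vecV≡ : CV.vec e ≡ CV.vec e'
      vecV≡ = complement-unique (proj₁ dimV) (proj₁ dimW) meet (CV.vec-∈ e) (CV.vec-∈ e')
                (residue-∈ (e , f)) (subst (λ x → W (x ⊕ CV.vec e')) (sym sum≡) (residue-∈ (e' , f')))
      vecW≡ : CW.vec f ≡ CW.vec f'
      vecW≡ = ⊕-cancelˡ (CV.vec e) _ _ (trans sum≡ (cong (_⊕ CW.vec f') (sym vecV≡)))

    pairs↔Fin : (Vec Bool r × Vec Bool s) ↔ Fin (2 ^ n)
    pairs↔Fin = ↔-trans (×-cong (Vec-Bool↔Fin r) (Vec-Bool↔Fin s))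
                  (subst (λ k → (Fin (2 ^ r) × Fin (2 ^ s)) ↔ Fin k)
                         (trans (sym (^-distribˡ-+-* 2 r s)) (cong (2 ^_) r+s≡n))
                         (↔-sym *↔×))

    split : ∀ x → ∃ λ v → V v × W (x ⊕ v)
    split x =
      let p , sum≡x = ↔Fin-injective⇒surjective pairs↔Fin (Vec-Bool↔Fin n) sum sum-injective x
      in  CV.vec (proj₁ p) , CV.vec-∈ (proj₁ p) , subst (λ y → W (y ⊕ CV.vec (proj₁ p))) sum≡x (residue-∈ p)

complementary-sym : ∀ {n} {V W : Subset n} → Complementary V W → Complementary W V
complementary-sym {V = V} V⊕W = record
  { V-isSubspace = W-isSubspace
  ; W-isSubspace = V-isSubspace
  ; meet         = meetTrivially-sym meet
  ; split        = λ x → let v , v∈V , x⊕v∈W = split x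
                         in  x ⊕ v , x⊕v∈W , subst V (sym (x⊕[x⊕y]≡y x v)) v∈V
  }
  where open Complementary V⊕W

module Projection {n} {V W : Subset n} (V⊕W : Complementary V W) where
  open Complementary V⊕W

  π : Vector n → Vector n
  π x = proj₁ (split x)

  π-∈ : ∀ x → V (π x)
  π-∈ x = proj₁ (proj₂ (split x))

  π-residue-∈ : ∀ x → W (x ⊕ π x)
  π-residue-∈ x = proj₂ (proj₂ (split x))

  π-unique : ∀ {x v} → V v → W (x ⊕ v) → π x ≡ v
  π-unique {x} v∈V x⊕v∈W =
    complement-unique V-isSubspace W-isSubspace meet (π-∈ x) v∈V (π-residue-∈ x) x⊕v∈W

  π-zero : π 0v ≡ 0v
  π-zero = π-unique (IsSubspace.zero∈ V-isSubspace)
                    (subst W (sym (⊕-self 0v)) (IsSubspace.zero∈ W-isSubspace))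

  module _ {U : Subset n} (U⊕W : Complementary U W) where
    private module U⊕W = Complementary U⊕W

    π-injectiveOn : ∀ {u u'} → U u → U u' → π u ≡ π u' → u ≡ u'
    π-injectiveOn {u} {u'} u∈U u'∈U πu≡πu' =
      complement-unique U⊕W.V-isSubspace W-isSubspace U⊕W.meet u∈U u'∈U
        (residue u) (subst (λ p → W (p ⊕ u')) (sym πu≡πu') (residue u'))
      where
      residue : ∀ y → W (π y ⊕ y)
      residue y = subst W (⊕-comm y (π y)) (π-residue-∈ y)

    π-nonzero : ∀ {u} → U u → u ≢ 0v → π u ≢ 0v
    π-nonzero u∈U u≢0v πu≡0v =
      u≢0v (π-injectiveOn u∈U (IsSubspace.zero∈ U⊕W.V-isSubspace) (trans πu≡0v (sym π-zero)))

    π-surjectiveOn : ∀ {v} → V v → ∃ λ u → U u × π u ≡ v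
    π-surjectiveOn {v} v∈V =
      let u , u∈U , v⊕u∈W = U⊕W.split v
      in  u , u∈U , π-unique v∈V (subst W (⊕-comm v u) v⊕u∈W)

module Punctured {a m} {A : Set a} (A↔ : A ↔ Fin (suc m)) (a₀ : A) where
  private
    module A = Inverse A↔

    to-injective : Injective _≡_ _≡_ A.to
    to-injective = Injection.injective (↔⇒↣ A↔)

    from-injective : Injective _≡_ _≡_ A.from
    from-injective = Injection.injective (↔⇒↣ (↔-sym A↔))

  enum : Fin m → A
  enum i = A.from (punchIn (A.to a₀) i)

  enum-≢ : ∀ i → enum i ≢ a₀
  enum-≢ i enumi≡a₀ =
    punchInᵢ≢i (A.to a₀) i (from-injective (trans enumi≡a₀ (sym (A.strictlyInverseʳ a₀))))

  enum-injective : Injective _≡_ _≡_ enum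
  enum-injective {i} {j} = punchIn-injective (A.to a₀) i j ∘ from-injective

  enum-surjective : ∀ {x} → x ≢ a₀ → ∃ λ i → enum i ≡ x
  enum-surjective {x} x≢a₀ =
    punchOut a₀≢x , trans (cong A.from (punchIn-punchOut a₀≢x)) (A.strictlyInverseʳ x)
    where
    a₀≢x : A.to a₀ ≢ A.to x
    a₀≢x = x≢a₀ ∘ sym ∘ to-injective

record NonzeroEnumeration {n} (V : Subset n) (m : ℕ) : Set where
  field
    point            : Fin m → Vector n
    point-∈          : ∀ i → V (point i)
    point-nonzero    : ∀ i → point i ≢ 0v
    point-injective  : Injective _≡_ _≡_ point
    point-surjective : ∀ {x} → V x → x ≢ 0v → ∃ λ i → point i ≡ x

opaque
  nonzeroEnumeration : ∀ {n r} {V : Subset n} → IsSubspaceOfDim V r → NonzeroEnumeration V (2 ^ r ∸ 1)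
  nonzeroEnumeration {r = r} {V} dimV = record
    { point            = vec ∘ enum
    ; point-∈          = vec-∈ ∘ enum
    ; point-nonzero    = λ i → enum-≢ i ∘ vec≡0v⇒≡zero
    ; point-injective  = enum-injective ∘ vec-injective
    ; point-surjective = surjective
    }
    where
    open Coordinates dimV

    1+[2^r∸1]≡2^r : suc (2 ^ r ∸ 1) ≡ 2 ^ r
    1+[2^r∸1]≡2^r = trans (+-comm 1 (2 ^ r ∸ 1)) (m∸n+n≡m (m^n>0 2 r))

    open Punctured (subst (λ k → Vec Bool r ↔ Fin k) (sym 1+[2^r∸1]≡2^r) (Vec-Bool↔Fin r))
                   (replicate r false)

    surjective : ∀ {x} → V x → x ≢ 0v → ∃ λ i → vec (enum i) ≡ x
    surjective x∈V x≢0v with e , vece≡x ← vec-surjective x∈V =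
      let i , enumi≡e = enum-surjective e≢0 in i , trans (cong vec enumi≡e) vece≡x
      where
      e≢0 : e ≢ replicate r false
      e≢0 e≡0 = x≢0v (trans (sym vece≡x) (trans (cong vec e≡0) vec-zero))

Plane : ∀ {n} → Vector n → Vector n → Subset n
Plane a c = Span (lookup (a ∷ c ∷ []))

module _ {n} {a c : Vector n} where

  Plane-lincomb : ∀ k → lincomb k (lookup (a ∷ c ∷ [])) ≡ scale (k zero) a ⊕ scale (k (suc zero)) c
  Plane-lincomb k = cong (scale (k zero) a ⊕_) (⊕-identityʳ _)

  Plane-∋ : ∀ u v → Plane a c (scale u a ⊕ scale v c)
  Plane-∋ u v = lookup (u ∷ v ∷ []) , sym (Plane-lincomb (lookup (u ∷ v ∷ [])))

  Plane-∋0 : Plane a c 0v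
  Plane-∋0 = subst (Plane a c) (⊕-identityˡ 0v) (Plane-∋ false false)

  Plane-∋ˡ : Plane a c a
  Plane-∋ˡ = subst (Plane a c) (⊕-identityʳ a) (Plane-∋ true false)

  Plane-∋ʳ : Plane a c c
  Plane-∋ʳ = subst (Plane a c) (⊕-identityˡ c) (Plane-∋ false true)

  Plane-∋⊕ : Plane a c (a ⊕ c)
  Plane-∋⊕ = Plane-∋ true true

  Plane-elements : ∀ {x} → Plane a c x → x ≡ 0v ⊎ x ≡ a ⊎ x ≡ c ⊎ x ≡ a ⊕ c
  Plane-elements {x} (k , x≡) = elements (k zero) (k (suc zero)) (trans x≡ (Plane-lincomb k))
    where
    elements : ∀ u v → x ≡ scale u a ⊕ scale v c → x ≡ 0v ⊎ x ≡ a ⊎ x ≡ c ⊎ x ≡ a ⊕ c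
    elements false false x≡ = inj₁ (trans x≡ (⊕-identityˡ 0v))
    elements true  false x≡ = inj₂ (inj₁ (trans x≡ (⊕-identityʳ a)))
    elements false true  x≡ = inj₂ (inj₂ (inj₁ (trans x≡ (⊕-identityˡ c))))
    elements true  true  x≡ = inj₂ (inj₂ (inj₂ x≡))

  Plane-dim : a ≢ 0v → c ≢ 0v → a ⊕ c ≢ 0v → IsSubspaceOfDim (Plane a c) 2
  Plane-dim a≢0v c≢0v a⊕c≢0v =
    Span-isSubspace basis , basis , independent , λ x → id , id
    where
    basis : Fin 2 → Vector n
    basis = lookup (a ∷ c ∷ [])

    trivial : ∀ u v → scale u a ⊕ scale v c ≡ 0v → u ≡ false × v ≡ false
    trivial false false _   = refl , refl
    trivial true  false eq = contradiction (trans (sym (⊕-identityʳ a)) eq) a≢0v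
    trivial false true  eq = contradiction (trans (sym (⊕-identityˡ c)) eq) c≢0v
    trivial true  true  eq = contradiction eq a⊕c≢0v

    independent : LinIndep basis
    independent k eq with trivial (k zero) (k (suc zero)) (trans (sym (Plane-lincomb k)) eq)
    ... | k₀≡false , k₁≡false = λ { zero → k₀≡false ; (suc zero) → k₁≡false }

module ThreeComplements {r} {V₁ V₂ V₃ : Subset (2 * r)} (1≤r : 1 ≤ r)
  (dim₁ : IsSubspaceOfDim V₁ r) (dim₂ : IsSubspaceOfDim V₂ r) (dim₃ : IsSubspaceOfDim V₃ r)
  (m₁₂ : MeetTrivially V₁ V₂) (m₁₃ : MeetTrivially V₁ V₃) (m₂₃ : MeetTrivially V₂ V₃) where

  private
    r+r≡2r : r + r ≡ 2 * r
    r+r≡2r = cong (r +_) (sym (+-identityʳ r))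

  V₁⊕V₂ : Complementary V₁ V₂
  V₁⊕V₂ = complementary-by-dim r+r≡2r dim₁ dim₂ m₁₂

  V₃⊕V₂ : Complementary V₃ V₂
  V₃⊕V₂ = complementary-by-dim r+r≡2r dim₃ dim₂ (meetTrivially-sym m₂₃)

  V₃⊕V₁ : Complementary V₃ V₁
  V₃⊕V₁ = complementary-by-dim r+r≡2r dim₃ dim₁ (meetTrivially-sym m₁₃)

  module π₁ = Projection V₁⊕V₂
  module π₂ = Projection (complementary-sym V₁⊕V₂)

  open NonzeroEnumeration (nonzeroEnumeration dim₃)
    renaming (point to s; point-∈ to s-∈; point-nonzero to s-nonzero;
              point-injective to s-injective; point-surjective to s-surjective)

  M : ℕ
  M = 2 ^ r ∸ 1

  a c : Fin M → Vector (2 * r)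
  a i = π₁.π (s i)
  c i = π₂.π (s i)

  a⊕c≡s : ∀ i → a i ⊕ c i ≡ s i
  a⊕c≡s i = begin
    a i ⊕ c i          ≡⟨ cong (a i ⊕_) c≡s⊕a ⟩
    a i ⊕ (s i ⊕ a i)  ≡⟨ cong (a i ⊕_) (⊕-comm (s i) (a i)) ⟩
    a i ⊕ (a i ⊕ s i)  ≡⟨ x⊕[x⊕y]≡y (a i) (s i) ⟩
    s i                ∎
    where
    open ≡-Reasoning
    c≡s⊕a : c i ≡ s i ⊕ a i
    c≡s⊕a = π₂.π-unique (π₁.π-residue-∈ (s i))
                        (subst V₁ (sym (x⊕[x⊕y]≡y (s i) (a i))) (π₁.π-∈ (s i)))

  a-injective : Injective _≡_ _≡_ a
  a-injective {i} {j} = s-injective ∘ π₁.π-injectiveOn V₃⊕V₂ (s-∈ i) (s-∈ j)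

  c-injective : Injective _≡_ _≡_ c
  c-injective {i} {j} = s-injective ∘ π₂.π-injectiveOn V₃⊕V₁ (s-∈ i) (s-∈ j)

  plane : Fin M → Subset (2 * r)
  plane i = Plane (a i) (c i)

  plane-dim : ∀ i → IsSubspaceOfDim (plane i) 2
  plane-dim i = Plane-dim (π₁.π-nonzero V₃⊕V₂ (s-∈ i) (s-nonzero i))
                          (π₂.π-nonzero V₃⊕V₁ (s-∈ i) (s-nonzero i))
                          (subst (_≢ 0v) (sym (a⊕c≡s i)) (s-nonzero i))

  plane-elements : ∀ {i x} → plane i x → x ≡ 0v ⊎ x ≡ a i ⊎ x ≡ c i ⊎ x ≡ s i
  plane-elements {i} = Sum.map₂ (Sum.map₂ (Sum.map₂ (λ x≡ → trans x≡ (a⊕c≡s i)))) ∘ Plane-elements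

  ∈V₁ : ∀ {x} i → x ≡ a i → V₁ x
  ∈V₁ i refl = π₁.π-∈ (s i)

  ∈V₂ : ∀ {x} i → x ≡ c i → V₂ x
  ∈V₂ i refl = π₂.π-∈ (s i)

  ∈V₃ : ∀ {x} i → x ≡ s i → V₃ x
  ∈V₃ i refl = s-∈ i

  planes-disjoint : ∀ i j → i ≢ j → MeetTrivially (plane i) (plane j)
  planes-disjoint i j i≢j x x∈i x∈j = cases (plane-elements x∈i) (plane-elements x∈j)
    where
    same : {f : Fin M → Vector (2 * r)} → Injective _≡_ _≡_ f → x ≡ f i → x ≡ f j → x ≡ 0v
    same f-injective x≡fi x≡fj = contradiction (f-injective (trans (sym x≡fi) x≡fj)) i≢j

    cases : x ≡ 0v ⊎ x ≡ a i ⊎ x ≡ c i ⊎ x ≡ s i → x ≡ 0v ⊎ x ≡ a j ⊎ x ≡ c j ⊎ x ≡ s j → x ≡ 0v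
    cases (inj₁ x≡0v)              _                        = x≡0v
    cases (inj₂ _)                 (inj₁ x≡0v)              = x≡0v
    cases (inj₂ (inj₁ x≡a))        (inj₂ (inj₁ x≡a'))        = same a-injective x≡a x≡a'
    cases (inj₂ (inj₁ x≡a))        (inj₂ (inj₂ (inj₁ x≡c'))) = m₁₂ x (∈V₁ i x≡a) (∈V₂ j x≡c')
    cases (inj₂ (inj₁ x≡a))        (inj₂ (inj₂ (inj₂ x≡s'))) = m₁₃ x (∈V₁ i x≡a) (∈V₃ j x≡s')
    cases (inj₂ (inj₂ (inj₁ x≡c))) (inj₂ (inj₁ x≡a'))        = m₁₂ x (∈V₁ j x≡a') (∈V₂ i x≡c)
    cases (inj₂ (inj₂ (inj₁ x≡c))) (inj₂ (inj₂ (inj₁ x≡c'))) = same c-injective x≡c x≡c'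
    cases (inj₂ (inj₂ (inj₁ x≡c))) (inj₂ (inj₂ (inj₂ x≡s'))) = m₂₃ x (∈V₂ i x≡c) (∈V₃ j x≡s')
    cases (inj₂ (inj₂ (inj₂ x≡s))) (inj₂ (inj₁ x≡a'))        = m₁₃ x (∈V₁ j x≡a') (∈V₃ i x≡s)
    cases (inj₂ (inj₂ (inj₂ x≡s))) (inj₂ (inj₂ (inj₁ x≡c'))) = m₂₃ x (∈V₂ j x≡c') (∈V₃ i x≡s)
    cases (inj₂ (inj₂ (inj₂ x≡s))) (inj₂ (inj₂ (inj₂ x≡s'))) = same s-injective x≡s x≡s'

  planes-⊆ : ∀ x → (∃ λ i → plane i x) → V₁ x ⊎ V₂ x ⊎ V₃ x
  planes-⊆ x (i , x∈i) with plane-elements x∈i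
  ... | inj₁ refl              = inj₁ (IsSubspace.zero∈ (proj₁ dim₁))
  ... | inj₂ (inj₁ x≡a)        = inj₁ (∈V₁ i x≡a)
  ... | inj₂ (inj₂ (inj₁ x≡c)) = inj₂ (inj₁ (∈V₂ i x≡c))
  ... | inj₂ (inj₂ (inj₂ x≡s)) = inj₂ (inj₂ (∈V₃ i x≡s))

  i₀ : Fin M
  i₀ = let x , x∈V₃ , x≢0v = Coordinates.nonzero-∈ dim₃ 1≤r
       in  proj₁ (s-surjective x∈V₃ x≢0v)

  image-in-planes : (f : Vector (2 * r) → Vector (2 * r)) → f 0v ≡ 0v → (∀ i → plane i (f (s i))) →
                    ∀ {u} → V₃ u → ∃ λ i → plane i (f u)
  image-in-planes f f0≡0v f∈ {u} u∈V₃ with Vec.≡-dec Bool._≟_ u 0v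
  ... | yes refl = i₀ , subst (plane i₀) (sym f0≡0v) Plane-∋0
  ... | no u≢0v with i , refl ← s-surjective u∈V₃ u≢0v = i , f∈ i

  planes-⊇ : ∀ x → V₁ x ⊎ V₂ x ⊎ V₃ x → ∃ λ i → plane i x
  planes-⊇ x (inj₁ x∈V₁) with u , u∈V₃ , refl ← π₁.π-surjectiveOn V₃⊕V₂ x∈V₁ =
    image-in-planes π₁.π π₁.π-zero (λ _ → Plane-∋ˡ) u∈V₃
  planes-⊇ x (inj₂ (inj₁ x∈V₂)) with u , u∈V₃ , refl ← π₂.π-surjectiveOn V₃⊕V₁ x∈V₂ =
    image-in-planes π₂.π π₂.π-zero (λ _ → Plane-∋ʳ) u∈V₃
  planes-⊇ x (inj₂ (inj₂ x∈V₃)) =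
    image-in-planes id refl (λ i → subst (plane i) (a⊕c≡s i) Plane-∋⊕) x∈V₃

lemma7 : (r : ℕ) → 1 ≤ r → (V₁ V₂ V₃ : Subset (2 * r)) →
         IsSubspaceOfDim V₁ r → IsSubspaceOfDim V₂ r → IsSubspaceOfDim V₃ r →
         MeetTrivially V₁ V₂ → MeetTrivially V₁ V₃ → MeetTrivially V₂ V₃ →
         Σ (Fin (2 ^ r ∸ 1) → Subset (2 * r)) (λ W →
           (∀ i → IsSubspaceOfDim (W i) 2) ×
           (∀ i j → i ≢ j → MeetTrivially (W i) (W j)) ×
           (∀ x → (∃ λ i → W i x) ⇔ (V₁ x ⊎ V₂ x ⊎ V₃ x)))
lemma7 r 1≤r V₁ V₂ V₃ dim₁ dim₂ dim₃ m₁₂ m₁₃ m₂₃ =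
  plane , plane-dim , planes-disjoint , λ x → mk⇔ (planes-⊆ x) (planes-⊇ x)
  where open ThreeComplements 1≤r dim₁ dim₂ dim₃ m₁₂ m₁₃ m₂₃
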